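{- Let $G=(V,E)$ be a finite undirected graph and let $\emptyset=B_0\subsetneq B_1\subsetneq\cdots\subsetneq B_k=V$ be all the locally dense subsets of $V$, listed in increasing order. Let $0\le x<y\le k$, set $\alpha=d(B_y,B_x)+|V|^{ -2}$, and let $z$ be such that $B_z=D(\alpha)$. If $x+1<y$, then $x<z<y$. If $x+1=y$, then $z=x$.
   Context: For $X\subseteq V$, $E(X)=\{(x,y)\in E: x,y\in X\}$. For disjoint $X,Y$, $E(X,Y)$ is the set of edges with one endpoint in $X$ and one in $Y$, $E_m(X,Y)=E(X)\cup E(X,Y)$, and for nonempty $X$ disjoint from $Y$, $d(X,Y)=|E_m(X,Y)|/|X|$; in general $d(X,Y)=d(X\setminus Y,Y)$. A set $W\subseteq V$ is locally dense if there do not exist a nonempty $X\subseteq W$ and a nonempty $Y\subseteq V$ with $Y\cap W=\emptyset$ such that $d(X,W\setminus X)\le d(Y,W)$. For a real number $\alpha$, $D(\alpha)$ denotes the maximizer of $|E(W)|-\alpha|W|$ over all $W\subseteq V$, where ties are resolved by picking the largest maximizing set $W$; $D(\alpha)$ is always one of the locally dense sets $B_z$. -}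

module Defs where

open import Data.Nat as ℕ using (ℕ; zero; suc; _<ᵇ_)
open import Data.Integer using (+_)
open import Data.Rational as ℚ using (ℚ; _/_; _+_; _-_; _*_; 0ℚ)
open import Data.Fin using (Fin; toℕ)
open import Data.Fin.Subset using (Subset; _∪_; _─_; _⊆_; _∩_; Nonempty; Empty)
open import Data.Vec using (lookup)
open import Data.Bool using (Bool; true; false; _∧_; _∨_; if_then_else_)
open import Data.List using (List; map; allFin)
open import Data.Nat.ListAction using (sum)
open import Data.Product using (∃; Σ; _×_; _,_)
open import Relation.Nullary using (¬_)
open import Relation.Binary.PropositionalEquality using (_≡_)

record Graph (n : ℕ) : Set where
  field
    adj     : Fin n → Fin n → Bool
    adj-sym : ∀ i j → adj i j ≡ adj j i
    adj-irr : ∀ i → adj i i ≡ false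
open Graph public

countPairs : {n : ℕ} → (Fin n → Fin n → Bool) → ℕ
countPairs {n} P =
  sum (map (λ i → sum (map (λ j → if (toℕ i <ᵇ toℕ j) ∧ P i j then 1 else 0)
                              (allFin n)))
           (allFin n))

module _ {n : ℕ} (G : Graph n) where

  eCount : Subset n → ℕ
  eCount X = countPairs (λ i j → adj G i j ∧ lookup X i ∧ lookup X j)

  emCount : Subset n → Subset n → ℕ
  emCount X Y = countPairs (λ i j → adj G i j
                                   ∧ (lookup X i ∨ lookup X j)
                                   ∧ lookup (X ∪ Y) i ∧ lookup (X ∪ Y) j)

  -- d(X,Y) = |E_m(X∖Y, Y)| / |X∖Y|.  Only meaningful when X∖Y is nonempty;
  -- the value 0 for empty X∖Y is an unused convention.
  dens : Subset n → Subset n → ℚ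
  dens X Y with Data.Fin.Subset.∣ X ─ Y ∣
  ... | zero  = 0ℚ
  ... | suc m = (+ emCount (X ─ Y) Y) / suc m

  LocallyDense : Subset n → Set
  LocallyDense W =
    ¬ (Σ (Subset n) λ X → Σ (Subset n) λ Y →
         X ⊆ W × Nonempty X × Nonempty Y × Empty (Y ∩ W) ×
         (dens X (W ─ X) ℚ.≤ dens Y W))

  objective : ℚ → Subset n → ℚ
  objective α W = (+ eCount W / 1) - α * (+ Data.Fin.Subset.∣ W ∣ / 1)

  IsD : ℚ → Subset n → Set
  IsD α W =
    (∀ W′ → objective α W′ ℚ.≤ objective α W) ×
    (∀ W′ → (∀ W″ → objective α W″ ℚ.≤ objective α W′) →
            Data.Fin.Subset.∣ W′ ∣ ℕ.≤ Data.Fin.Subset.∣ W ∣)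

invSq : ℕ → ℚ
invSq zero    = 0ℚ
invSq (suc m) = (+ 1) / (suc m ℕ.* suc m)

-- Write F(W) = |E(W)| - α|W|.  For A ⊂ B one has F(B) - F(A) = |B∖A| (d(B,A) - α), and
-- local density of B forces d(C,B) < d(B,A) whenever A ⊂ B ⊂ C.  Hence every step above
-- B_y has density below d(B_y,B_x) < α, so D(α) is not at or above B_y.  Densities are
-- fractions with denominators at most |V|, so any density exceeding d(B_y,B_x) is at least α.
-- This applies to d(B_x,B_z) when z < x, and, through the mediant inequality, to
-- d(B_(x+1),B_x) when x + 1 < y; in both cases a strictly larger set has F at least as
-- large, contradicting that D(α) is the largest maximiser.

module Submission where

open import Defs
open import Data.Nat using (ℕ; suc; _<_; _≤_)
open import Data.Fin using (Fin; toℕ; fromℕ)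
open import Data.Fin.Subset using (Subset; ⊥; ⊤; _⊂_)
open import Data.Rational using (_+_)
open import Data.Product using (∃; _×_)
open import Relation.Binary.PropositionalEquality using (_≡_)

open import Data.Bool using (Bool; true; false; _∧_; _∨_; not; if_then_else_)
open import Data.Bool.Properties using (∧-zeroʳ; ∧-identityʳ)
open import Data.Fin using (fromℕ<)
open import Data.Fin.Properties using (toℕ-injective; toℕ<n; toℕ-fromℕ<)
open import Data.Fin.Subset using (_─_; _∪_; _∩_; _⊆_; _∈_; ∣_∣; Nonempty; inside; outside)
open import Data.Fin.Subset.Properties
  using (drop-∷-⊆; ∉⊥; ∣p∣≤n; p⊂q⇒∣p∣<∣q∣; ⊂-trans; p─q⊆p; p─q─q≡p─q; x∈p∧x∉q⇒x∈p─q)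
open import Data.Integer using (+_)
import Data.Integer as ℤ
import Data.Integer.Properties as ℤ
open import Data.List using ([]; _∷_; map; allFin)
import Data.Nat as ℕ
open import Data.Nat.ListAction using (sum)
import Data.Nat.Properties as ℕ
open import Data.Nat.Tactic.RingSolver using (solve-∀)
open import Data.Product using (_,_; proj₁)
open import Data.Rational using (ℚ; 0ℚ; _/_; _-_; _*_; toℚᵘ)
import Data.Rational as ℚ
import Data.Rational.Properties as ℚ
open import Data.Rational.Solver using (module +-*-Solver)
open import Data.Rational.Unnormalised as ℚᵘ using (mkℚᵘ; *≡*; *≤*; *<*)
import Data.Rational.Unnormalised.Properties as ℚᵘ
open import Data.Sum using (inj₁; inj₂)
open import Data.Vec using (_∷_; []; lookup; here)
open import Data.Vec.Properties using (lookup-zipWith)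
open import Function using (_∘_; case_of_)
open import Relation.Binary.PropositionalEquality
  using (refl; sym; trans; cong; cong₂; subst; subst₂; _≢_; module ≡-Reasoning)
open import Relation.Nullary using (¬_; contradiction)

lookup-─ : ∀ {n} (p q : Subset n) i → lookup (p ─ q) i ≡ lookup p i ∧ not (lookup q i)
lookup-─ (x ∷ p) (inside  ∷ q) Fin.zero = sym (∧-zeroʳ x)
lookup-─ (x ∷ p) (outside ∷ q) Fin.zero = sym (∧-identityʳ x)
lookup-─ (x ∷ p) (y ∷ q) (Fin.suc i) = lookup-─ p q i

∣p─q∣+∣q∣≡∣p∪q∣ : ∀ {n} (p q : Subset n) → ∣ p ─ q ∣ ℕ.+ ∣ q ∣ ≡ ∣ p ∪ q ∣
∣p─q∣+∣q∣≡∣p∪q∣ []            []            = refl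
∣p─q∣+∣q∣≡∣p∪q∣ (inside  ∷ p) (inside  ∷ q) = trans (ℕ.+-suc _ _) (cong suc (∣p─q∣+∣q∣≡∣p∪q∣ p q))
∣p─q∣+∣q∣≡∣p∪q∣ (outside ∷ p) (inside  ∷ q) = trans (ℕ.+-suc _ _) (cong suc (∣p─q∣+∣q∣≡∣p∪q∣ p q))
∣p─q∣+∣q∣≡∣p∪q∣ (inside  ∷ p) (outside ∷ q) = cong suc (∣p─q∣+∣q∣≡∣p∪q∣ p q)
∣p─q∣+∣q∣≡∣p∪q∣ (outside ∷ p) (outside ∷ q) = ∣p─q∣+∣q∣≡∣p∪q∣ p q

q⊆p⇒p∪q≡p : ∀ {n} {p q : Subset n} → q ⊆ p → p ∪ q ≡ p
q⊆p⇒p∪q≡p {p = []}          {[]}          _ = refl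
q⊆p⇒p∪q≡p {p = inside  ∷ p} {_       ∷ q} q⊆p = cong (inside ∷_) (q⊆p⇒p∪q≡p (drop-∷-⊆ q⊆p))
q⊆p⇒p∪q≡p {p = outside ∷ p} {outside ∷ q} q⊆p = cong (outside ∷_) (q⊆p⇒p∪q≡p (drop-∷-⊆ q⊆p))
q⊆p⇒p∪q≡p {p = outside ∷ p} {inside  ∷ q} q⊆p with () ← q⊆p here

p⊂q⇒Nonempty[q─p] : ∀ {n} {p q : Subset n} → p ⊂ q → Nonempty (q ─ p)
p⊂q⇒Nonempty[q─p] (_ , x , x∈q , x∉p) = x , x∈p∧x∉q⇒x∈p─q x∈q x∉p

q⊆p⇒∣p─q∣+∣q∣≡∣p∣ : ∀ {n} {p q : Subset n} → q ⊆ p → ∣ p ─ q ∣ ℕ.+ ∣ q ∣ ≡ ∣ p ∣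
q⊆p⇒∣p─q∣+∣q∣≡∣p∣ {p = p} {q} q⊆p = trans (∣p─q∣+∣q∣≡∣p∪q∣ p q) (cong ∣_∣ (q⊆p⇒p∪q≡p q⊆p))

q⊆p⇒p─[p─q]≡q : ∀ {n} {p q : Subset n} → q ⊆ p → p ─ (p ─ q) ≡ q
q⊆p⇒p─[p─q]≡q {p = []}          {[]}          _ = refl
q⊆p⇒p─[p─q]≡q {p = inside  ∷ p} {inside  ∷ q} q⊆p = cong (inside ∷_) (q⊆p⇒p─[p─q]≡q (drop-∷-⊆ q⊆p))
q⊆p⇒p─[p─q]≡q {p = inside  ∷ p} {outside ∷ q} q⊆p = cong (outside ∷_) (q⊆p⇒p─[p─q]≡q (drop-∷-⊆ q⊆p))
q⊆p⇒p─[p─q]≡q {p = outside ∷ p} {outside ∷ q} q⊆p = cong (outside ∷_) (q⊆p⇒p─[p─q]≡q (drop-∷-⊆ q⊆p))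
q⊆p⇒p─[p─q]≡q {p = outside ∷ p} {inside  ∷ q} q⊆p with () ← q⊆p here

[p─q]∩q≡⊥ : ∀ {n} (p q : Subset n) → (p ─ q) ∩ q ≡ ⊥
[p─q]∩q≡⊥ []            []            = refl
[p─q]∩q≡⊥ (_       ∷ p) (inside  ∷ q) = cong (outside ∷_) ([p─q]∩q≡⊥ p q)
[p─q]∩q≡⊥ (inside  ∷ p) (outside ∷ q) = cong (outside ∷_) ([p─q]∩q≡⊥ p q)
[p─q]∩q≡⊥ (outside ∷ p) (outside ∷ q) = cong (outside ∷_) ([p─q]∩q≡⊥ p q)

sum-map-+ : ∀ {A : Set} {f g h : A → ℕ} → (∀ a → f a ℕ.+ g a ≡ h a) →
            ∀ xs → sum (map f xs) ℕ.+ sum (map g xs) ≡ sum (map h xs)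
sum-map-+ f+g≡h []       = refl
sum-map-+ {f = f} {g} f+g≡h (a ∷ xs) = begin
  (f a ℕ.+ F) ℕ.+ (g a ℕ.+ G) ≡⟨ interchange (f a) F (g a) G ⟩
  (f a ℕ.+ g a) ℕ.+ (F ℕ.+ G) ≡⟨ cong₂ ℕ._+_ (f+g≡h a) (sum-map-+ f+g≡h xs) ⟩
  _                           ∎
  where
  open ≡-Reasoning
  F G : ℕ
  F = sum (map f xs)
  G = sum (map g xs)
  interchange : ∀ a b c d → (a ℕ.+ b) ℕ.+ (c ℕ.+ d) ≡ (a ℕ.+ c) ℕ.+ (b ℕ.+ d)
  interchange = solve-∀

indicator : Bool → ℕ
indicator b = if b then 1 else 0

countPairs-+ : ∀ {n} {P Q R : Fin n → Fin n → Bool} →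
               (∀ i j → indicator (P i j) ℕ.+ indicator (Q i j) ≡ indicator (R i j)) →
               countPairs P ℕ.+ countPairs Q ≡ countPairs R
countPairs-+ {n} P+Q≡R =
  sum-map-+ (λ i → sum-map-+ (λ j → restrict (toℕ i ℕ.<ᵇ toℕ j) (P+Q≡R i j)) (allFin n)) (allFin n)
  where
  restrict : ∀ c {a b d} → indicator a ℕ.+ indicator b ≡ indicator d →
             indicator (c ∧ a) ℕ.+ indicator (c ∧ b) ≡ indicator (c ∧ d)
  restrict true  e = e
  restrict false e = refl

↑_ : ℕ → ℚ
↑ a = + a / 1

toℚᵘ-/suc : ∀ p d → toℚᵘ (p / suc d) ℚᵘ.≃ mkℚᵘ p d
toℚᵘ-/suc p d = ℚ.toℚᵘ-fromℚᵘ (mkℚᵘ p d)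

module _ {a b c d : ℕ} where

  /-<-/⇒*<* : + a / suc b ℚ.< + c / suc d → a ℕ.* suc d ℕ.< c ℕ.* suc b
  /-<-/⇒*<* lt
    with ℚᵘ.<-respˡ-≃ (toℚᵘ-/suc (+ a) b) (ℚᵘ.<-respʳ-≃ (toℚᵘ-/suc (+ c) d) (ℚ.toℚᵘ-mono-< lt))
  ... | *<* lt′ = ℤ.drop‿+<+ (subst₂ ℤ._<_ (sym (ℤ.pos-* a (suc d))) (sym (ℤ.pos-* c (suc b))) lt′)

  *<*⇒/-<-/ : a ℕ.* suc d ℕ.< c ℕ.* suc b → + a / suc b ℚ.< + c / suc d
  *<*⇒/-<-/ lt = ℚ.toℚᵘ-cancel-<
    (ℚᵘ.<-respˡ-≃ (ℚᵘ.≃-sym (toℚᵘ-/suc (+ a) b)) (ℚᵘ.<-respʳ-≃ (ℚᵘ.≃-sym (toℚᵘ-/suc (+ c) d))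
      (*<* (subst₂ ℤ._<_ (ℤ.pos-* a (suc d)) (ℤ.pos-* c (suc b)) (ℤ.+<+ lt)))))

  *≤*⇒/-≤-/ : a ℕ.* suc d ℕ.≤ c ℕ.* suc b → + a / suc b ℚ.≤ + c / suc d
  *≤*⇒/-≤-/ le = ℚ.toℚᵘ-cancel-≤
    (ℚᵘ.≤-respˡ-≃ (ℚᵘ.≃-sym (toℚᵘ-/suc (+ a) b)) (ℚᵘ.≤-respʳ-≃ (ℚᵘ.≃-sym (toℚᵘ-/suc (+ c) d))
      (*≤* (subst₂ ℤ._≤_ (ℤ.pos-* a (suc d)) (ℤ.pos-* c (suc b)) (ℤ.+≤+ le)))))

  /-+-/ : + a / suc b + + c / suc d ≡ + (a ℕ.* suc d ℕ.+ c ℕ.* suc b) / (suc b ℕ.* suc d)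
  /-+-/ = ℚ.toℚᵘ-injective (begin
    toℚᵘ (+ a / suc b + + c / suc d)                  ≈⟨ ℚ.toℚᵘ-homo-+ (+ a / suc b) (+ c / suc d) ⟩
    toℚᵘ (+ a / suc b) ℚᵘ.+ toℚᵘ (+ c / suc d)         ≈⟨ ℚᵘ.+-cong (toℚᵘ-/suc (+ a) b) (toℚᵘ-/suc (+ c) d) ⟩
    mkℚᵘ (+ a ℤ.* + suc d ℤ.+ + c ℤ.* + suc b) _      ≈⟨ ℚᵘ.≃-reflexive (cong (λ p → mkℚᵘ p _) numerator) ⟩
    mkℚᵘ (+ (a ℕ.* suc d ℕ.+ c ℕ.* suc b)) _          ≈⟨ ℚᵘ.≃-sym (toℚᵘ-/suc _ _) ⟩
    toℚᵘ (+ (a ℕ.* suc d ℕ.+ c ℕ.* suc b) / (suc b ℕ.* suc d)) ∎)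
    where
    open import Relation.Binary.Reasoning.Setoid ℚᵘ.≃-setoid
    numerator : + a ℤ.* + suc d ℤ.+ + c ℤ.* + suc b ≡ + (a ℕ.* suc d ℕ.+ c ℕ.* suc b)
    numerator = sym (trans (ℤ.pos-+ (a ℕ.* suc d) (c ℕ.* suc b))
                           (cong₂ ℤ._+_ (ℤ.pos-* a (suc d)) (ℤ.pos-* c (suc b))))

↑-+ : ∀ a c → ↑ (a ℕ.+ c) ≡ ↑ a + ↑ c
↑-+ a c = sym (trans (/-+-/ {a} {0} {c} {0})
                     (cong (λ t → + t / 1) (cong₂ ℕ._+_ (ℕ.*-identityʳ a) (ℕ.*-identityʳ c))))

/-*-cancel : ∀ m s → + m / suc s * ↑ (suc s) ≡ ↑ m
/-*-cancel m s = ℚ.toℚᵘ-injective (ℚᵘ.≃-trans (ℚ.toℚᵘ-homo-* (+ m / suc s) (↑ suc s))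
  (ℚᵘ.≃-trans (ℚᵘ.*-cong (toℚᵘ-/suc (+ m) s) (toℚᵘ-/suc (+ suc s) 0))
  (ℚᵘ.≃-trans (*≡* cross) (ℚᵘ.≃-sym (toℚᵘ-/suc (+ m) 0)))))
  where
  cross : (+ m ℤ.* + suc s) ℤ.* ℤ.1ℤ ≡ + m ℤ.* + (suc s ℕ.* 1)
  cross = trans (ℤ.*-identityʳ _) (cong (λ t → + m ℤ.* + t) (sym (ℕ.*-identityʳ (suc s))))

mediant-< : ∀ {a b c d} → + c / suc d ℚ.< + a / suc b →
            + (c ℕ.+ a) / (suc d ℕ.+ suc b) ℚ.< + a / suc b
mediant-< {a} {b} {c} {d} lt = *<*⇒/-<-/ {c ℕ.+ a} {d ℕ.+ suc b} {a} {b} (begin-strict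
  (c ℕ.+ a) ℕ.* suc b            ≡⟨ ℕ.*-distribʳ-+ (suc b) c a ⟩
  c ℕ.* suc b ℕ.+ a ℕ.* suc b    <⟨ ℕ.+-monoˡ-< (a ℕ.* suc b) (/-<-/⇒*<* {c} {d} {a} {b} lt) ⟩
  a ℕ.* suc d ℕ.+ a ℕ.* suc b    ≡⟨ ℕ.*-distribˡ-+ a (suc d) (suc b) ⟨
  a ℕ.* (suc d ℕ.+ suc b)        ∎)
  where open ℕ.≤-Reasoning

/-<-/⇒+invSq≤ : ∀ {a b c d n} → suc b ≤ n → suc d ≤ n → + a / suc b ℚ.< + c / suc d →
                + a / suc b + invSq n ℚ.≤ + c / suc d
/-<-/⇒+invSq≤ {a} {b} {c} {d} {suc m} b<n d<n lt =
  subst (ℚ._≤ + c / suc d) (sym (/-+-/ {a} {b} {1} {m ℕ.+ m ℕ.* suc m}))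
    (*≤*⇒/-≤-/ {a ℕ.* N ℕ.+ 1 ℕ.* B} {ℕ.pred (B ℕ.* N)} {c} {d} (begin
    (a ℕ.* N ℕ.+ 1 ℕ.* B) ℕ.* D   ≡⟨ regroup a B D N ⟩
    a ℕ.* D ℕ.* N ℕ.+ B ℕ.* D     ≤⟨ ℕ.+-monoʳ-≤ (a ℕ.* D ℕ.* N) (ℕ.*-mono-≤ b<n d<n) ⟩
    a ℕ.* D ℕ.* N ℕ.+ N           ≡⟨ ℕ.+-comm (a ℕ.* D ℕ.* N) N ⟩
    suc (a ℕ.* D) ℕ.* N           ≤⟨ ℕ.*-monoˡ-≤ N (/-<-/⇒*<* {a} {b} {c} {d} lt) ⟩
    c ℕ.* B ℕ.* N                 ≡⟨ ℕ.*-assoc c B N ⟩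
    c ℕ.* (B ℕ.* N)               ∎))
  where
  open ℕ.≤-Reasoning
  B D N : ℕ
  B = suc b
  D = suc d
  N = suc m ℕ.* suc m
  regroup : ∀ a B D N → (a ℕ.* N ℕ.+ 1 ℕ.* B) ℕ.* D ≡ a ℕ.* D ℕ.* N ℕ.+ B ℕ.* D
  regroup = solve-∀

invSq-positive : ∀ {n} → 0 < n → 0ℚ ℚ.< invSq n
invSq-positive {suc m} _ = ℚ.positive⁻¹ (invSq (suc m)) {{ℚ.normalize-pos 1 (suc m ℕ.* suc m)}}

ratio : ℕ → ℕ → ℚ
ratio e 0       = 0ℚ
ratio e (suc s) = + e / suc s

module _ {n : ℕ} (G : Graph n) where

  emCount-─+eCount≡eCount-∪ : ∀ X Y → emCount G (X ─ Y) Y ℕ.+ eCount G Y ≡ eCount G (X ∪ Y)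
  emCount-─+eCount≡eCount-∪ X Y = countPairs-+ pointwise
    where
    pointwise : ∀ i j →
      indicator (adj G i j ∧ (lookup (X ─ Y) i ∨ lookup (X ─ Y) j)
                           ∧ lookup ((X ─ Y) ∪ Y) i ∧ lookup ((X ─ Y) ∪ Y) j)
      ℕ.+ indicator (adj G i j ∧ lookup Y i ∧ lookup Y j)
      ≡ indicator (adj G i j ∧ lookup (X ∪ Y) i ∧ lookup (X ∪ Y) j)
    pointwise i j
      rewrite lookup-zipWith _∨_ i (X ─ Y) Y | lookup-zipWith _∨_ j (X ─ Y) Y
            | lookup-─ X Y i | lookup-─ X Y j
            | lookup-zipWith _∨_ i X Y | lookup-zipWith _∨_ j X Y
            = split (adj G i j) (lookup X i) (lookup Y i) (lookup X j) (lookup Y j)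
      where
      split : ∀ a xi yi xj yj →
        indicator (a ∧ (xi ∧ not yi ∨ xj ∧ not yj) ∧ (xi ∧ not yi ∨ yi) ∧ (xj ∧ not yj ∨ yj))
        ℕ.+ indicator (a ∧ yi ∧ yj)
        ≡ indicator (a ∧ (xi ∨ yi) ∧ (xj ∨ yj))
      split false _     _     _     _     = refl
      split true  false false false false = refl
      split true  false false false true  = refl
      split true  false false true  false = refl
      split true  false false true  true  = refl
      split true  false true  false false = refl
      split true  false true  false true  = refl
      split true  false true  true  false = refl
      split true  false true  true  true  = refl
      split true  true  false false false = refl
      split true  true  false false true  = refl
      split true  true  false true  false = refl
      split true  true  false true  true  = refl
      split true  true  true  false false = refl
      split true  true  true  false true  = refl
      split true  true  true  true  false = refl
      split true  true  true  true  true  = refl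

  dens≡ratio : ∀ X Y → dens G X Y ≡ ratio (emCount G (X ─ Y) Y) ∣ X ─ Y ∣
  dens≡ratio X Y with ∣ X ─ Y ∣
  ... | 0     = refl
  ... | suc s = refl

  dens-─ : ∀ X Y → dens G (X ─ Y) Y ≡ dens G X Y
  dens-─ X Y = begin
    dens G (X ─ Y) Y                                ≡⟨ dens≡ratio (X ─ Y) Y ⟩
    ratio (emCount G (X ─ Y ─ Y) Y) ∣ X ─ Y ─ Y ∣  ≡⟨ cong (λ Z → ratio (emCount G Z Y) ∣ Z ∣) (p─q─q≡p─q X Y) ⟩
    ratio (emCount G (X ─ Y) Y) ∣ X ─ Y ∣          ≡⟨ dens≡ratio X Y ⟨
    dens G X Y                                      ∎
    where open ≡-Reasoning

  record Extension (A B : Subset n) : Set where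
    field
      e s       : ℕ
      eCount-≡  : eCount G B ≡ e ℕ.+ eCount G A
      ∣∣-≡      : ∣ B ∣ ≡ suc s ℕ.+ ∣ A ∣
      dens-≡    : dens G B A ≡ + e / suc s
      s<n       : s < n

  open Extension

  extension : ∀ {A B} → A ⊂ B → Extension A B
  extension {A} {B} A⊂B with ∣ B ─ A ∣ in ∣B─A∣≡
  ... | 0     = contradiction (trans (sym (q⊆p⇒∣p─q∣+∣q∣≡∣p∣ (proj₁ A⊂B))) (cong (ℕ._+ ∣ A ∣) ∣B─A∣≡))
                              (ℕ.<⇒≢ (p⊂q⇒∣p∣<∣q∣ A⊂B) ∘ sym)
  ... | suc s = record
    { e        = emCount G (B ─ A) A
    ; s        = s
    ; eCount-≡ = sym (trans (emCount-─+eCount≡eCount-∪ B A) (cong (eCount G) (q⊆p⇒p∪q≡p (proj₁ A⊂B))))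
    ; ∣∣-≡     = trans (sym (q⊆p⇒∣p─q∣+∣q∣≡∣p∣ (proj₁ A⊂B))) (cong (ℕ._+ ∣ A ∣) ∣B─A∣≡)
    ; dens-≡   = trans (dens≡ratio B A) (cong (ratio _) ∣B─A∣≡)
    ; s<n      = subst (_≤ n) ∣B─A∣≡ (∣p∣≤n (B ─ A))
    }

  module _ {α : ℚ} {A B : Subset n} (X : Extension A B) where

    private
      S : ℚ
      S = ↑ suc (s X)
      S-positive : ℚ.Positive S
      S-positive = ℚ.normalize-pos (suc (s X)) 1

    objective-extension : objective G α B + S * α ≡ objective G α A + S * dens G B A
    objective-extension = begin
      objective G α B + S * α                               ≡⟨ cong₂ (λ u v → (u - α * v) + S * α) edges size ⟩
      ((↑ e X + ↑ eCount G A) - α * (S + ↑ ∣ A ∣)) + S * α  ≡⟨ regroup (↑ e X) (↑ eCount G A) S (↑ ∣ A ∣) α ⟩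
      objective G α A + ↑ e X                               ≡⟨ cong (objective G α A ℚ.+_) gain ⟨
      objective G α A + S * dens G B A                      ∎
      where
      open ≡-Reasoning
      edges : ↑ eCount G B ≡ ↑ e X + ↑ eCount G A
      edges = trans (cong ↑_ (eCount-≡ X)) (↑-+ (e X) (eCount G A))
      size : ↑ ∣ B ∣ ≡ S + ↑ ∣ A ∣
      size = trans (cong ↑_ (∣∣-≡ X)) (↑-+ (suc (s X)) ∣ A ∣)
      gain : S * dens G B A ≡ ↑ e X
      gain = trans (ℚ.*-comm S _) (trans (cong (_* S) (dens-≡ X)) (/-*-cancel (e X) (s X)))
      regroup : ∀ m a s c α → ((m + a) - α * (s + c)) + s * α ≡ (a - α * c) + m
      regroup = solve 5 (λ m a s c α → ((m :+ a) :- α :* (s :+ c)) :+ s :* α := (a :- α :* c) :+ m) refl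
        where open +-*-Solver

    objective-≤ : α ℚ.≤ dens G B A → objective G α A ℚ.≤ objective G α B
    objective-≤ α≤d = ℚ.≮⇒≥ λ objB<objA → ℚ.<-irrefl objective-extension (ℚ.<-≤-trans
      (ℚ.+-monoˡ-< (S * α) objB<objA)
      (ℚ.+-monoʳ-≤ (objective G α A) (ℚ.*-monoˡ-≤-nonNeg S {{ℚ.pos⇒nonNeg S {{S-positive}}}} α≤d)))

    objective-< : dens G B A ℚ.< α → objective G α B ℚ.< objective G α A
    objective-< d<α = ℚ.≰⇒> λ objA≤objB → ℚ.<-irrefl (sym objective-extension) (ℚ.<-≤-trans
      (ℚ.+-monoʳ-< (objective G α A) (ℚ.*-monoʳ-<-pos S {{S-positive}} d<α))
      (ℚ.+-monoˡ-≤ (S * α) objA≤objB))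

  ¬IsD-below : ∀ {α A B} → A ⊂ B → α ℚ.≤ dens G B A → ¬ IsD G α A
  ¬IsD-below {B = B} A⊂B α≤d (maximum , largest) =
    ℕ.<⇒≱ (p⊂q⇒∣p∣<∣q∣ A⊂B) (largest B (λ W → ℚ.≤-trans (maximum W) (objective-≤ (extension A⊂B) α≤d)))

  ¬IsD-above : ∀ {α A B} → A ⊂ B → dens G B A ℚ.< α → ¬ IsD G α B
  ¬IsD-above {A = A} A⊂B d<α (maximum , _) =
    ℚ.<-irrefl refl (ℚ.<-≤-trans (objective-< (extension A⊂B) d<α) (maximum A))

  dens<dens+invSq : ∀ {A B} → A ⊂ B → dens G B A ℚ.< dens G B A + invSq n
  dens<dens+invSq {A} {B} A⊂B = subst (ℚ._< dens G B A + invSq n) (ℚ.+-identityʳ (dens G B A))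
    (ℚ.+-monoʳ-< (dens G B A) (invSq-positive (ℕ.≤-<-trans ℕ.z≤n (s<n (extension A⊂B)))))

  dens-gap : ∀ {A B C D} → A ⊂ B → C ⊂ D → dens G B A ℚ.< dens G D C →
             dens G B A + invSq n ℚ.≤ dens G D C
  dens-gap {A} {B} {C} {D} A⊂B C⊂D lt =
    subst₂ (λ p q → p + invSq n ℚ.≤ q) (sym (dens-≡ AB)) (sym (dens-≡ CD))
      (/-<-/⇒+invSq≤ {e AB} {s AB} {e CD} {s CD} (s<n AB) (s<n CD)
        (subst₂ ℚ._<_ (dens-≡ AB) (dens-≡ CD) lt))
    where
    AB : Extension A B
    AB = extension A⊂B
    CD : Extension C D
    CD = extension C⊂D

  dens-mediant : ∀ {A B C} → A ⊂ B → B ⊂ C → dens G C B ℚ.< dens G B A → dens G C A ℚ.< dens G B A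
  dens-mediant {A} {B} {C} A⊂B B⊂C lt =
    subst₂ ℚ._<_ (sym dens[C,A]) (sym (dens-≡ AB))
      (mediant-< {e AB} {s AB} {e BC} {s BC} (subst₂ ℚ._<_ (dens-≡ BC) (dens-≡ AB) lt))
    where
    AB : Extension A B
    AB = extension A⊂B
    BC : Extension B C
    BC = extension B⊂C
    AC : Extension A C
    AC = extension (⊂-trans A⊂B B⊂C)
    increments-add : ∀ {f : Subset n → ℕ} {x y z} →
      f C ≡ x ℕ.+ f B → f B ≡ y ℕ.+ f A → f C ≡ z ℕ.+ f A → z ≡ x ℕ.+ y
    increments-add {f} {x} {y} {z} C≡ B≡ C≡′ = ℕ.+-cancelʳ-≡ (f A) z (x ℕ.+ y)
      (trans (sym C≡′) (trans C≡ (trans (cong (x ℕ.+_) B≡) (sym (ℕ.+-assoc x y (f A))))))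
    dens[C,A] : dens G C A ≡ + (e BC ℕ.+ e AB) / (suc (s BC) ℕ.+ suc (s AB))
    dens[C,A] = trans (dens-≡ AC) (cong₂ (λ m t → + m / suc t)
      (increments-add (eCount-≡ BC) (eCount-≡ AB) (eCount-≡ AC))
      (ℕ.suc-injective (increments-add (∣∣-≡ BC) (∣∣-≡ AB) (∣∣-≡ AC))))

  locallyDense⇒dens-< : ∀ {A B C} → A ⊂ B → B ⊂ C → LocallyDense G B → dens G C B ℚ.< dens G B A
  locallyDense⇒dens-< {A} {B} {C} A⊂B B⊂C dense = ℚ.≰⇒> λ d[B,A]≤d[C,B] → dense
    ( B ─ A , C ─ B , p─q⊆p B A , p⊂q⇒Nonempty[q─p] A⊂B , p⊂q⇒Nonempty[q─p] B⊂C
    , (λ (x , x∈) → ∉⊥ (subst (x ∈_) ([p─q]∩q≡⊥ C B) x∈))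
    , subst₂ ℚ._≤_ (sym dens[B─A,A]) (sym (dens-─ C B)) d[B,A]≤d[C,B] )
    where
    dens[B─A,A] : dens G (B ─ A) (B ─ (B ─ A)) ≡ dens G B A
    dens[B─A,A] = trans (cong (dens G (B ─ A)) (q⊆p⇒p─[p─q]≡q (proj₁ A⊂B))) (dens-─ B A)

proposition4 : {n : ℕ} (G : Graph n) (k : ℕ) (B : Fin (suc k) → Subset n) →
    B Data.Fin.zero ≡ ⊥ → B (fromℕ k) ≡ ⊤ →
    (∀ i j → toℕ i < toℕ j → B i ⊂ B j) →
    (∀ i → LocallyDense G (B i)) →
    (∀ W → LocallyDense G W → ∃ λ i → B i ≡ W) →
    (x y z : Fin (suc k)) → toℕ x < toℕ y →
    IsD G (dens G (B y) (B x) + invSq n) (B z) →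
    (suc (toℕ x) < toℕ y → toℕ x < toℕ z × toℕ z < toℕ y) ×
    (suc (toℕ x) ≡ toℕ y → z ≡ x)
proposition4 {n} G k B _ _ chain dense _ x y z x<y isD = between , adjacent
  where
  α : ℚ
  α = dens G (B y) (B x) + invSq n
  Bx⊂By : B x ⊂ B y
  Bx⊂By = chain x y x<y

  z<y : toℕ z < toℕ y
  z<y = ℕ.≰⇒> λ y≤z → case ℕ.m≤n⇒m<n∨m≡n y≤z of λ where
    (inj₁ y<z) → ¬IsD-above G (chain y z y<z)
      (ℚ.<-trans (locallyDense⇒dens-< G Bx⊂By (chain y z y<z) (dense y)) (dens<dens+invSq G Bx⊂By)) isD
    (inj₂ y≡z) → ¬IsD-above G Bx⊂By (dens<dens+invSq G Bx⊂By)
      (subst (IsD G α ∘ B) (toℕ-injective (sym y≡z)) isD)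

  x≤z : toℕ x ≤ toℕ z
  x≤z = ℕ.≮⇒≥ λ z<x → ¬IsD-below G (chain z x z<x)
    (dens-gap G Bx⊂By (chain z x z<x) (locallyDense⇒dens-< G (chain z x z<x) Bx⊂By (dense x))) isD

  z≢x : suc (toℕ x) < toℕ y → z ≢ x
  z≢x x+1<y refl = ¬IsD-below G Bx⊂Bw
    (dens-gap G Bx⊂By Bx⊂Bw
      (dens-mediant G Bx⊂Bw Bw⊂By (locallyDense⇒dens-< G Bx⊂Bw Bw⊂By (dense w)))) isD
    where
    w : Fin (suc k)
    w = fromℕ< (ℕ.<-trans x+1<y (toℕ<n y))
    w≡x+1 : toℕ w ≡ suc (toℕ x)
    w≡x+1 = toℕ-fromℕ< (ℕ.<-trans x+1<y (toℕ<n y))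
    Bx⊂Bw : B x ⊂ B w
    Bx⊂Bw = chain x w (subst (toℕ x <_) (sym w≡x+1) (ℕ.n<1+n (toℕ x)))
    Bw⊂By : B w ⊂ B y
    Bw⊂By = chain w y (subst (_< toℕ y) (sym w≡x+1) x+1<y)

  between : suc (toℕ x) < toℕ y → toℕ x < toℕ z × toℕ z < toℕ y
  between x+1<y = ℕ.≤∧≢⇒< x≤z (z≢x x+1<y ∘ toℕ-injective ∘ sym) , z<y

  adjacent : suc (toℕ x) ≡ toℕ y → z ≡ x
  adjacent x+1≡y = toℕ-injective (ℕ.≤-antisym (ℕ.≤-pred (subst (toℕ z <_) (sym x+1≡y) z<y)) x≤z)
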